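{- Let $G$ be a strongly regular graph with parameters $(n,d,\lambda,\mu)$. If $\mathcal{P}_n,\mathcal{P}_{n-1},\dots,\mathcal{P}_k$ is a partial contraction sequence of $G$ of width at most $\operatorname{lb}_1(G)$, then $|P|\leq 2$ for every part $P\in\mathcal{P}_i$ whenever $k\leq i\leq n$ and $i\geq n-\left\lceil\frac{\operatorname{lb}_1(G)}{2}\right\rceil$.
   Context: A graph is strongly regular with parameters $(n,d,\lambda,\mu)$ if it has $n$ vertices, is $d$-regular, any two adjacent vertices have exactly $\lambda$ common neighbors and any two distinct non-adjacent vertices have exactly $\mu$ common neighbors. A trigraph is a graph whose edges are colored red or black; a graph is a trigraph with all edges black. For a partition $\mathcal{P}$ of $V(G)$, the quotient trigraph $G/\mathcal{P}$ has vertex set $\mathcal{P}$; two parts $U,W$ are joined by a black edge if every pair $u\in U,w\in W$ is an edge, are non-adjacent if no such pair is an edge, and are joined by a red edge otherwise. A partial contraction sequence is a sequence $\mathcal{P}_n,\dots,\mathcal{P}_k$ of partitions of $V(G)$ with $\mathcal{P}_n$ discrete and each $\mathcal{P}_i$ obtained from $\mathcal{P}_{i+1}$ by merging two parts; its width is the maximum red degree over all $G/\mathcal{P}_i$. For $G$ with at least two vertices, $\operatorname{lb}_1(G)$ is the minimum, over pairs of distinct vertices $u,v$, of the maximum red degree of $G/\mathcal{P}$ where $\mathcal{P}$ has $\{u,v\}$ as its only non-singleton part. -}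

module Defs where

open import Data.Nat using (ℕ; zero; suc; _+_; _⊔_; _⊓_; _≤_; _<_; _∸_; ⌈_/2⌉)
open import Data.Bool using (Bool; true; false; if_then_else_; _∧_; _∨_; not)
open import Data.Fin using (Fin; _≟_)
open import Data.List using (List; []; _∷_; map; foldr; allFin; concatMap)
open import Data.Nat.ListAction using (sum)
open import Data.Product using (Σ; _×_; _,_)
open import Data.Sum using (_⊎_)
open import Relation.Nullary using (¬_)
open import Relation.Nullary.Decidable using (⌊_⌋)
open import Relation.Binary.PropositionalEquality using (_≡_; _≢_)

record Graph (n : ℕ) : Set where
  field
    adj   : Fin n → Fin n → Bool
    sym   : ∀ u v → adj u v ≡ adj v u
    irrefl : ∀ v → adj v v ≡ false
open Graph public

count : {n : ℕ} → (Fin n → Bool) → ℕ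
count {n} p = sum (map (λ x → if p x then 1 else 0) (allFin n))

anyV : {n : ℕ} → (Fin n → Bool) → Bool
anyV {n} p = foldr (λ x b → p x ∨ b) false (allFin n)

degree : {n : ℕ} → Graph n → Fin n → ℕ
degree G v = count (λ w → adj G v w)

common : {n : ℕ} → Graph n → Fin n → Fin n → ℕ
common G u v = count (λ w → adj G u w ∧ adj G v w)

record StronglyRegular {n : ℕ} (G : Graph n) (d lam mu : ℕ) : Set where
  field
    regular  : ∀ v → degree G v ≡ d
    adjacent : ∀ u v → u ≢ v → adj G u v ≡ true → common G u v ≡ lam
    nonadj   : ∀ u v → u ≢ v → adj G u v ≡ false → common G u v ≡ mu

-- A partition of Fin n, represented by a labelling of vertices; the parts are
-- the non-empty fibres of the labelling (labels are themselves in Fin n).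
Labelling : ℕ → Set
Labelling n = Fin n → Fin n

same : {n : ℕ} → Labelling n → Fin n → Fin n → Set
same P u v = P u ≡ P v

inPart : {n : ℕ} → Labelling n → Fin n → Fin n → Bool
inPart P ℓ u = ⌊ P u ≟ ℓ ⌋

redEdge : {n : ℕ} → Graph n → Labelling n → Fin n → Fin n → Bool
redEdge G P ℓ ℓ' =
  anyV (λ u → inPart P ℓ u ∧ anyV (λ w → inPart P ℓ' w ∧ adj G u w))
  ∧ anyV (λ u → inPart P ℓ u ∧ anyV (λ w → inPart P ℓ' w ∧ not (adj G u w)))

redDeg : {n : ℕ} → Graph n → Labelling n → Fin n → ℕ
redDeg G P ℓ = count (λ ℓ' → not ⌊ ℓ ≟ ℓ' ⌋ ∧ redEdge G P ℓ ℓ')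

-- maximum red degree of G/P (unused labels are empty parts with red degree 0)
maxRedDeg : {n : ℕ} → Graph n → Labelling n → ℕ
maxRedDeg {n} G P = foldr _⊔_ 0 (map (redDeg G P) (allFin n))

pairPartition : {n : ℕ} → Fin n → Fin n → Labelling n
pairPartition u v w = if ⌊ w ≟ v ⌋ then u else w

minList : List ℕ → ℕ
minList []       = 0
minList (x ∷ xs) = foldr _⊓_ x xs

-- lb₁(G): minimum over pairs of distinct vertices u , v of the maximum red
-- degree of G/{u,v}.  (For n < 2 it is set to 0; it is not used then.)
lb1 : {n : ℕ} → Graph n → ℕ
lb1 {n} G = minList (concatMap (λ u → concatMap (λ v →
  if ⌊ u ≟ v ⌋ then [] else (maxRedDeg G (pairPartition u v) ∷ [])) (allFin n)) (allFin n))

-- P is obtained from P' by merging two (distinct, non-empty) parts of P':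
-- those containing x and y.
MergeOf : {n : ℕ} → Labelling n → Labelling n → Set
MergeOf {n} P P' = Σ (Fin n) λ x → Σ (Fin n) λ y →
  ¬ same P' x y ×
  (∀ u v → (same P u v → (same P' u v ⊎ (same P' u x × same P' v y) ⊎ (same P' u y × same P' v x)))
         × ((same P' u v ⊎ (same P' u x × same P' v y) ⊎ (same P' u y × same P' v x)) → same P u v))

-- A partial contraction sequence P_n , … , P_k of G (indexed by i, k ≤ i ≤ n):
-- P_n discrete, and P_i obtained from P_{i+1} by merging two parts.
record PartialContractionSequence (n k : ℕ) (P : ℕ → Labelling n) : Set where
  field
    discrete : ∀ u v → same (P n) u v → u ≡ v
    merges   : ∀ i → k ≤ i → i < n → MergeOf (P i) (P (suc i))

WidthAtMost : {n : ℕ} → Graph n → ℕ → (ℕ → Labelling n) → ℕ → Set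
WidthAtMost {n} G k P w = ∀ i → k ≤ i → i ≤ n → maxRedDeg G (P i) ≤ w

partSize : {n : ℕ} → Labelling n → Fin n → ℕ
partSize P u = count (λ v → ⌊ P v ≟ P u ⌋)

-- In a d-regular graph the vertices other than x and y that are
-- adjacent to exactly one of them number 2 (d − |N(x) ∩ N(y)| − [x ∼ y]), an even number, and no
-- red degree of G/{x, y} exceeds it; so there are at least 2a of them, where a = ⌈lb₁(G)/2⌉.
-- Suppose a part X of P_i, with i ≥ n − a, contains distinct u, v, w, and let M be the vertices
-- outside {u, v, w} adjacent to some but not all of them.  A vertex of M distinguishes exactly two
-- of the pairs uv, uw, vw, and each of u, v, w at most one, so 6a ≤ 2|M| + 3.  On the other hand
-- every vertex of M ∪ X lies in X or in a red neighbour of X, and each of the n − i ≤ a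
-- contractions lowers the number of parts meeting a fixed set by at most one; hence
-- |M| + 3 ≤ |M ∪ X| ≤ lb₁(G) + 1 + a ≤ 3a + 1, which contradicts the first bound.
module Submission where

open import Defs
open import Data.Nat using (ℕ; _≤_; _∸_; ⌈_/2⌉)
open import Data.Fin using (Fin)

open import Data.Bool using (Bool; true; false; if_then_else_; not; _∧_; _∨_; _xor_; T)
open import Data.Bool.ListAction using (any)
open import Data.Bool.Properties using (T-∧; T-∨; T-≡; T-not-≡; xor-identityʳ)
open import Data.Empty using (⊥; ⊥-elim)
open import Data.Fin using (zero; suc; _≟_)
import Data.Fin.Properties as Finₚ
open import Data.List using ([]; _∷_; allFin; tabulate)
open import Data.List.Membership.Propositional using (_∈_; lose)
open import Data.List.Membership.Propositional.Properties using (∈-allFin; ∈-map⁺; ∈-concatMap⁺)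
open import Data.List.Properties using (map-tabulate; foldr-map; foldr-preservesᵇ; foldr-preservesᵒ)
open import Data.List.Relation.Unary.All using (universal)
import Data.List.Relation.Unary.All.Properties as All
open import Data.List.Relation.Unary.Any using (Any; here; there; satisfied)
import Data.List.Relation.Unary.Any as Any
open import Data.List.Relation.Unary.Any.Properties using (any⁺; any⁻)
open import Data.Nat using (zero; suc; _+_; _<_; _⊓_; z≤n; s≤s; _≤?_)
open import Data.Nat.ListAction using () renaming (sum to sumList)
open import Data.Nat.Properties
  using ( ≤-refl; ≤-trans; ≤-reflexive; ≤-pred; <-irrefl; n<1+n; ≰⇒>; m≤n⇒m≤1+n; m<m+n
        ; +-mono-≤; +-monoˡ-≤; +-monoʳ-≤; +-identityʳ; +-suc; +-comm; suc-injective
        ; +-0-commutativeMonoid; +-commutativeSemigroup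
        ; m≤n+m∸n; m≤n+o⇒m∸n≤o; m+[n∸m]≡n
        ; ⊔-lub; m≤n⇒m≤n⊔o; m≤n⇒m≤o⊔n; m≤n⇒m⊓o≤n; m≤n⇒o⊓m≤n
        ; ⌈n/2⌉-mono; n≡⌈n+n/2⌉; ⌊n/2⌋+⌈n/2⌉≡n; ⌊n/2⌋≤⌈n/2⌉ )
import Data.Nat.Properties as ℕ
open import Data.Nat.Tactic.RingSolver using (solve-∀)
open import Algebra.Properties.CommutativeMonoid.Sum +-0-commutativeMonoid
  using (sum; sum-syntax; ∑-distrib-+; sum-cong-≗; sum-replicate-zero)
open import Algebra.Properties.CommutativeSemigroup +-commutativeSemigroup using (x∙yz≈y∙xz)
open import Data.Product using (∃; ∃₂; _×_; _,_; proj₁; proj₂)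
import Data.Product as Product
open import Data.Sum using (_⊎_; inj₁; inj₂; [_,_])
open import Data.Unit using (tt)
open import Function using (_∘_; _$_; id; Equivalence)
open import Relation.Nullary using (yes; no; contradiction)
open import Relation.Nullary.Decidable
  using (⌊_⌋; ⌊⌋-map′; toWitness; fromWitness; toWitnessFalse; fromWitnessFalse)
open import Relation.Binary.PropositionalEquality
  using (_≡_; _≢_; refl; trans; cong; cong₂; subst; subst₂; module ≡-Reasoning)
import Relation.Binary.PropositionalEquality as ≡

open Equivalence

even-summand : ∀ x k d → x + (k + k) ≡ d + d → ∃ λ t → x ≡ t + t
even-summand x zero    d       eq = d , trans (≡.sym (+-identityʳ x)) eq
even-summand x (suc k) zero    eq = contradiction (trans (≡.sym (+-suc x (k + suc k))) eq) λ ()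
even-summand x (suc k) (suc d) eq = even-summand x k d (suc-injective (suc-injective (begin
  suc (suc (x + (k + k)))  ≡⟨ shift x k ⟩
  x + (suc k + suc k)      ≡⟨ eq ⟩
  suc d + suc d            ≡⟨ cong suc (+-suc d d) ⟩
  suc (suc (d + d))        ∎)))
  where
  open ≡-Reasoning
  shift : ∀ x k → suc (suc (x + (k + k))) ≡ x + (suc k + suc k)
  shift = solve-∀

⌈/2⌉-double≤ : ∀ {L t} → L ≤ t + t → ⌈ L /2⌉ + ⌈ L /2⌉ ≤ t + t
⌈/2⌉-double≤ {L} {t} L≤2t = +-mono-≤ half half
  where
  half : ⌈ L /2⌉ ≤ t
  half = subst (⌈ L /2⌉ ≤_) (≡.sym (n≡⌈n+n/2⌉ t)) (⌈n/2⌉-mono L≤2t)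

≤⌈/2⌉-double : ∀ L → L ≤ ⌈ L /2⌉ + ⌈ L /2⌉
≤⌈/2⌉-double L = subst (_≤ ⌈ L /2⌉ + ⌈ L /2⌉) (⌊n/2⌋+⌈n/2⌉≡n L) (+-monoˡ-≤ _ (⌊n/2⌋≤⌈n/2⌉ L))

m∸n≤o⇒m∸o≤n : ∀ m n o → m ∸ n ≤ o → m ∸ o ≤ n
m∸n≤o⇒m∸o≤n m n o m∸n≤o = m≤n+o⇒m∸n≤o m o (begin
  m            ≤⟨ m≤n+m∸n m n ⟩
  n + (m ∸ n)  ≤⟨ +-monoʳ-≤ n m∸n≤o ⟩
  n + o        ≡⟨ +-comm n o ⟩
  o + n        ∎)
  where open ℕ.≤-Reasoning

incompatible-bounds : ∀ D a → 3 + D ≤ suc (a + a) + a → (a + a) + (a + a) + (a + a) ≤ 3 + (D + D) → ⊥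
incompatible-bounds D a upper lower = <-irrefl refl (begin-strict
  2 + (3 + (D + D))                      <⟨ n<1+n _ ⟩
  3 + (3 + (D + D))                      ≡⟨ double-upper D ⟩
  (3 + D) + (3 + D)                      ≤⟨ +-mono-≤ upper upper ⟩
  (suc (a + a) + a) + (suc (a + a) + a)  ≡⟨ double-lower a ⟩
  2 + ((a + a) + (a + a) + (a + a))      ≤⟨ +-monoʳ-≤ 2 lower ⟩
  2 + (3 + (D + D))                      ∎)
  where
  open ℕ.≤-Reasoning
  double-upper : ∀ D → 3 + (3 + (D + D)) ≡ (3 + D) + (3 + D)
  double-upper = solve-∀
  double-lower : ∀ a → (suc (a + a) + a) + (suc (a + a) + a) ≡ 2 + ((a + a) + (a + a) + (a + a))
  double-lower = solve-∀

𝟙 : Bool → ℕ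
𝟙 b = if b then 1 else 0

𝟙≤1 : ∀ b → 𝟙 b ≤ 1
𝟙≤1 false = z≤n
𝟙≤1 true  = ≤-refl

𝟙-mono : ∀ {a b} → (T a → T b) → 𝟙 a ≤ 𝟙 b
𝟙-mono {false}         _   = z≤n
𝟙-mono {true}  {true}  _   = ≤-refl
𝟙-mono {true}  {false} a⇒b = ⊥-elim (a⇒b tt)

infixl 6 _∖_

_∖_ : ∀ {n} → (Fin n → Bool) → Fin n → (Fin n → Bool)
(p ∖ x) z = not ⌊ z ≟ x ⌋ ∧ p z

module _ {n : ℕ} {x : Fin n} where

  ∖⁺ : ∀ {p : Fin n → Bool} {z} → z ≢ x → T (p z) → T ((p ∖ x) z)
  ∖⁺ z≢x pz = from T-∧ (fromWitnessFalse z≢x , pz)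

  ∖⁻ : ∀ {p : Fin n → Bool} {z} → T ((p ∖ x) z) → z ≢ x × T (p z)
  ∖⁻ h = Product.map₁ toWitnessFalse (to T-∧ h)

  ∖-mono : ∀ {p q : Fin n → Bool} → (∀ z → T (p z) → T (q z)) → ∀ z → T ((p ∖ x) z) → T ((q ∖ x) z)
  ∖-mono {p} {q} p⊆q z h = let z≢x , pz = ∖⁻ {p = p} h in ∖⁺ {p = q} z≢x (p⊆q z pz)

∑-mono : ∀ {n} {f g : Fin n → ℕ} → (∀ i → f i ≤ g i) → sum f ≤ sum g
∑-mono {zero}  _   = z≤n
∑-mono {suc n} f≤g = +-mono-≤ (f≤g zero) (∑-mono (f≤g ∘ suc))

sumList-tabulate : ∀ {n} (f : Fin n → ℕ) → sumList (tabulate f) ≡ sum f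
sumList-tabulate {zero}  f = refl
sumList-tabulate {suc n} f = cong (f zero +_) (sumList-tabulate (f ∘ suc))

count-∑ : ∀ {n} (p : Fin n → Bool) → count p ≡ ∑[ z < n ] 𝟙 (p z)
count-∑ p = trans (cong sumList (map-tabulate id (𝟙 ∘ p))) (sumList-tabulate (𝟙 ∘ p))

count-+ : ∀ {n} (p q : Fin n → Bool) → ∑[ z < n ] (𝟙 (p z) + 𝟙 (q z)) ≡ count p + count q
count-+ p q = trans (∑-distrib-+ (𝟙 ∘ p) (𝟙 ∘ q)) (≡.sym (cong₂ _+_ (count-∑ p) (count-∑ q)))

count-+₃ : ∀ {n} (p q r : Fin n → Bool) →
           ∑[ z < n ] (𝟙 (p z) + 𝟙 (q z) + 𝟙 (r z)) ≡ count p + count q + count r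
count-+₃ p q r = trans (∑-distrib-+ _ (𝟙 ∘ r)) (cong₂ _+_ (count-+ p q) (≡.sym (count-∑ r)))

count-false : ∀ {n} → count {n} (λ _ → false) ≡ 0
count-false {n} = trans (count-∑ {n} (λ _ → false)) (sum-replicate-zero n)

count-mono : ∀ {n} {p q : Fin n → Bool} → (∀ z → T (p z) → T (q z)) → count p ≤ count q
count-mono {p = p} {q} p⊆q =
  subst₂ _≤_ (≡.sym (count-∑ p)) (≡.sym (count-∑ q)) (∑-mono λ z → 𝟙-mono (p⊆q z))

∑-remove : ∀ {n} (p : Fin n → Bool) x → ∑[ z < n ] 𝟙 (p z) ≡ 𝟙 (p x) + ∑[ z < n ] 𝟙 ((p ∖ x) z)
∑-remove p zero    = refl
∑-remove p (suc x) = begin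
  𝟙 (p zero) + ∑[ z < _ ] 𝟙 (p (suc z))
    ≡⟨ cong (𝟙 (p zero) +_) (∑-remove (p ∘ suc) x) ⟩
  𝟙 (p zero) + (𝟙 (p (suc x)) + ∑[ z < _ ] 𝟙 ((p ∘ suc ∖ x) z))
    ≡⟨ x∙yz≈y∙xz (𝟙 (p zero)) (𝟙 (p (suc x))) _ ⟩
  𝟙 (p (suc x)) + (𝟙 (p zero) + ∑[ z < _ ] 𝟙 ((p ∘ suc ∖ x) z))
    ≡⟨ cong (λ s → 𝟙 (p (suc x)) + (𝟙 (p zero) + s)) (sum-cong-≗ λ z →
         -- ⌊ suc z ≟ suc x ⌋ and ⌊ z ≟ x ⌋ agree only propositionally
         cong (λ b → 𝟙 (not b ∧ p (suc z))) (≡.sym (⌊⌋-map′ _ _ (z ≟ x)))) ⟩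
  𝟙 (p (suc x)) + ∑[ z < _ ] 𝟙 ((p ∖ suc x) z)
    ∎
  where open ≡-Reasoning

count-remove : ∀ {n} (p : Fin n → Bool) x → count p ≡ 𝟙 (p x) + count (p ∖ x)
count-remove p x =
  trans (count-∑ p) (trans (∑-remove p x) (cong (𝟙 (p x) +_) (≡.sym (count-∑ (p ∖ x)))))

count-remove-∈ : ∀ {n} (p : Fin n → Bool) {x} → T (p x) → count p ≡ suc (count (p ∖ x))
count-remove-∈ p {x} px with p x | count-remove p x
... | true | eq = eq

count-≤-suc : ∀ {n} {p q : Fin n → Bool} {x} → (∀ z → z ≢ x → T (p z) → T (q z)) →
              count p ≤ suc (count q)
count-≤-suc {p = p} {q} {x} p⊆q∪x = begin
  count p                  ≡⟨ count-remove p x ⟩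
  𝟙 (p x) + count (p ∖ x)  ≤⟨ +-mono-≤ (𝟙≤1 (p x)) (count-mono p∖x⊆q) ⟩
  suc (count q)            ∎
  where
  open ℕ.≤-Reasoning
  p∖x⊆q : ∀ z → T ((p ∖ x) z) → T (q z)
  p∖x⊆q z h = let z≢x , pz = ∖⁻ {p = p} h in p⊆q∪x z z≢x pz

count-singleton : ∀ {n} (x : Fin n) → count (λ z → ⌊ z ≟ x ⌋) ≤ 1
count-singleton {n} x =
  ≤-trans (count-≤-suc {p = λ z → ⌊ z ≟ x ⌋} {q = λ _ → false} λ z z≢x z≡x → z≢x (toWitness z≡x))
          (≤-reflexive (cong suc (count-false {n})))

∑-witness : ∀ {n} (p : Fin n → Bool) → 0 < ∑[ z < n ] 𝟙 (p z) → ∃ λ z → T (p z)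
∑-witness {suc n} p pos with p zero in p₀
... | true  = zero , from T-≡ p₀
... | false = let z , pz = ∑-witness (p ∘ suc) pos in suc z , pz

count-witness : ∀ {n} (p : Fin n → Bool) → 0 < count p → ∃ λ z → T (p z)
count-witness p pos = ∑-witness p (subst (0 <_) (count-∑ p) pos)

∑-injection : ∀ {m n} {p : Fin m → Bool} {q : Fin n → Bool} (f : ∀ x → T (p x) → Fin n) →
              (∀ x px → T (q (f x px))) → (∀ x y px py → f x px ≡ f y py → x ≡ y) →
              ∑[ x < m ] 𝟙 (p x) ≤ count q
∑-injection {zero}              _ _   _     = z≤n
∑-injection {suc m} {p = p} {q} f f∈q f-inj with p zero in p₀
... | false = ∑-injection (f ∘ suc) (f∈q ∘ suc) λ x y px py eq → Finₚ.suc-injective (f-inj _ _ px py eq)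
... | true  = begin
  suc (∑[ x < m ] 𝟙 (p (suc x)))  ≤⟨ s≤s (∑-injection (f ∘ suc) avoids-f₀ λ x y px py eq →
                                        Finₚ.suc-injective (f-inj _ _ px py eq)) ⟩
  suc (count (q ∖ f zero p0))     ≡⟨ count-remove-∈ q (f∈q zero p0) ⟨
  count q                         ∎
  where
  open ℕ.≤-Reasoning
  p0 : T (p zero)
  p0 = from T-≡ p₀
  avoids-f₀ : ∀ x px → T ((q ∖ f zero p0) (f (suc x) px))
  avoids-f₀ x px = ∖⁺ {p = q} (λ eq → Finₚ.0≢1+n (f-inj _ _ p0 px (≡.sym eq))) (f∈q (suc x) px)

count-injection : ∀ {m n} {p : Fin m → Bool} {q : Fin n → Bool} (f : ∀ x → T (p x) → Fin n) →
                  (∀ x px → T (q (f x px))) → (∀ x y px py → f x px ≡ f y py → x ≡ y) →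
                  count p ≤ count q
count-injection {p = p} f f∈q f-inj = subst (_≤ _) (≡.sym (count-∑ p)) (∑-injection f f∈q f-inj)

three-elements : ∀ {n} {p : Fin n → Bool} {u} → 3 ≤ count p → T (p u) →
                 ∃₂ λ v w → u ≢ v × u ≢ w × v ≢ w × T (p v) × T (p w)
three-elements {p = p} {u} 3≤p pu =
  let v , h₁   = count-witness (p ∖ u) (≤-trans (s≤s z≤n) 2≤p∖u)
      v≢u , pv = ∖⁻ {p = p} h₁
      w , h₂   = count-witness (p ∖ u ∖ v) (≤-pred (subst (2 ≤_) (count-remove-∈ (p ∖ u) h₁) 2≤p∖u))
      w≢v , h₃ = ∖⁻ {p = p ∖ u} h₂
      w≢u , pw = ∖⁻ {p = p} h₃
  in v , w , v≢u ∘ ≡.sym , w≢u ∘ ≡.sym , w≢v ∘ ≡.sym , pv , pw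
  where
  2≤p∖u : 2 ≤ count (p ∖ u)
  2≤p∖u = ≤-pred (subst (3 ≤_) (count-remove-∈ p pu) 3≤p)

-- Distinguishing vertices

symDiff : ∀ {n} → Graph n → Fin n → Fin n → Fin n → Bool
symDiff G x y z = adj G x z xor adj G y z

distinguishers : ∀ {n} → Graph n → Fin n → Fin n → Fin n → Bool
distinguishers G x y = symDiff G x y ∖ x ∖ y

𝟙-xor : ∀ a b → 𝟙 a + 𝟙 b ≡ 𝟙 (a xor b) + (𝟙 (a ∧ b) + 𝟙 (a ∧ b))
𝟙-xor false false = refl
𝟙-xor false true  = refl
𝟙-xor true  false = refl
𝟙-xor true  true  = refl

⌊≟⌋-≢ : ∀ {n} {x y : Fin n} → x ≢ y → ⌊ x ≟ y ⌋ ≡ false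
⌊≟⌋-≢ {x = x} {y} x≢y with x ≟ y
... | yes x≡y = contradiction x≡y x≢y
... | no  _   = refl

module _ {n} (G : Graph n) {x y : Fin n} where

  degree+degree : degree G x + degree G y ≡ count (symDiff G x y) + (common G x y + common G x y)
  degree+degree = begin
    degree G x + degree G y
      ≡⟨ count-+ (adj G x) (adj G y) ⟨
    ∑[ z < n ] (𝟙 (adj G x z) + 𝟙 (adj G y z))
      ≡⟨ sum-cong-≗ (λ z → 𝟙-xor (adj G x z) (adj G y z)) ⟩
    ∑[ z < n ] (𝟙 (symDiff G x y z) + (𝟙 (adj G x z ∧ adj G y z) + 𝟙 (adj G x z ∧ adj G y z)))
      ≡⟨ ∑-distrib-+ (𝟙 ∘ symDiff G x y) _ ⟩
    ∑[ z < n ] 𝟙 (symDiff G x y z) + ∑[ z < n ] (𝟙 (adj G x z ∧ adj G y z) + 𝟙 (adj G x z ∧ adj G y z))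
      ≡⟨ cong₂ _+_ (≡.sym (count-∑ (symDiff G x y))) (count-+ N N) ⟩
    count (symDiff G x y) + (common G x y + common G x y)
      ∎
    where
    open ≡-Reasoning
    N : Fin n → Bool
    N z = adj G x z ∧ adj G y z

  symDiff-distinguishers : x ≢ y →
    count (symDiff G x y) ≡ 𝟙 (adj G x y) + (𝟙 (adj G x y) + count (distinguishers G x y))
  symDiff-distinguishers x≢y = begin
    count (symDiff G x y)
      ≡⟨ count-remove (symDiff G x y) x ⟩
    𝟙 (symDiff G x y x) + count (symDiff G x y ∖ x)
      ≡⟨ cong₂ (λ a b → 𝟙 a + b) at-x (count-remove (symDiff G x y ∖ x) y) ⟩
    𝟙 (adj G x y) + (𝟙 ((symDiff G x y ∖ x) y) + count (distinguishers G x y))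
      ≡⟨ cong (λ a → 𝟙 (adj G x y) + (𝟙 a + count (distinguishers G x y))) at-y ⟩
    𝟙 (adj G x y) + (𝟙 (adj G x y) + count (distinguishers G x y))
      ∎
    where
    open ≡-Reasoning
    at-x : symDiff G x y x ≡ adj G x y
    at-x = trans (cong (_xor adj G y x) (irrefl G x)) (Graph.sym G y x)
    at-y : (symDiff G x y ∖ x) y ≡ adj G x y
    at-y = trans (cong₂ (λ a b → not a ∧ (adj G x y xor b)) (⌊≟⌋-≢ (x≢y ∘ ≡.sym)) (irrefl G y))
                 (xor-identityʳ (adj G x y))

  distinguishers-even : ∀ {d} → (∀ v → degree G v ≡ d) → x ≢ y →
                        ∃ λ t → count (distinguishers G x y) ≡ t + t
  distinguishers-even {d} regular x≢y = even-summand Δ (c + a) d (begin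
    Δ + ((c + a) + (c + a))          ≡⟨ rearrange Δ c a ⟩
    (a + (a + Δ)) + (c + c)          ≡⟨ cong (_+ (c + c)) (symDiff-distinguishers x≢y) ⟨
    count (symDiff G x y) + (c + c)  ≡⟨ degree+degree ⟨
    degree G x + degree G y          ≡⟨ cong₂ _+_ (regular x) (regular y) ⟩
    d + d                            ∎)
    where
    open ≡-Reasoning
    Δ c a : ℕ
    Δ = count (distinguishers G x y)
    c = common G x y
    a = 𝟙 (adj G x y)
    rearrange : ∀ Δ c a → Δ + ((c + a) + (c + a)) ≡ (a + (a + Δ)) + (c + c)
    rearrange = solve-∀

-- Red edges of a quotient trigraph

anyV≡any : ∀ {n} (p : Fin n → Bool) → anyV p ≡ any p (allFin n)
anyV≡any p = ≡.sym (foldr-map _∨_ p false (allFin _))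

anyV⁺ : ∀ {n} {p : Fin n → Bool} z → T (p z) → T (anyV p)
anyV⁺ {p = p} z pz = subst T (≡.sym (anyV≡any p)) (any⁺ p (lose (∈-allFin z) pz))

anyV⁻ : ∀ {n} {p : Fin n → Bool} → T (anyV p) → ∃ λ z → T (p z)
anyV⁻ {p = p} h = satisfied (any⁻ p (allFin _) (subst T (anyV≡any p) h))

CrossPair : ∀ {n} → Graph n → Labelling n → Fin n → Fin n → Bool → Set
CrossPair {n} G P ℓ ℓ' b = ∃₂ λ (u w : Fin n) → P u ≡ ℓ × P w ≡ ℓ' × adj G u w ≡ b

CrossPair-swap : ∀ {n} (G : Graph n) {P ℓ ℓ' b} → CrossPair G P ℓ ℓ' b → CrossPair G P ℓ' ℓ b
CrossPair-swap G (u , w , Pu , Pw , uw) = w , u , Pw , Pu , trans (Graph.sym G w u) uw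

redNeighbours : ∀ {n} → Graph n → Labelling n → Fin n → Fin n → Bool
redNeighbours G P ℓ ℓ' = not ⌊ ℓ ≟ ℓ' ⌋ ∧ redEdge G P ℓ ℓ'

module _ {n} (G : Graph n) (P : Labelling n) {ℓ ℓ' : Fin n} where

  private
    Crossing : (Fin n → Fin n → Bool) → Bool
    Crossing r = anyV λ u → inPart P ℓ u ∧ anyV λ w → inPart P ℓ' w ∧ r u w

    crossing⁺ : ∀ {r u w} → P u ≡ ℓ → P w ≡ ℓ' → T (r u w) → T (Crossing r)
    crossing⁺ {u = u} {w} Pu Pw r =
      anyV⁺ u (from T-∧ (fromWitness Pu , anyV⁺ w (from T-∧ (fromWitness Pw , r))))

    crossing⁻ : ∀ {r} → T (Crossing r) → ∃₂ λ u w → P u ≡ ℓ × P w ≡ ℓ' × T (r u w)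
    crossing⁻ h =
      let u , h₁ = anyV⁻ h; Pu , h₂ = to T-∧ h₁
          w , h₃ = anyV⁻ h₂; Pw , r = to T-∧ h₃
      in u , w , toWitness Pu , toWitness Pw , r

  redEdge⁺ : CrossPair G P ℓ ℓ' true → CrossPair G P ℓ ℓ' false → T (redEdge G P ℓ ℓ')
  redEdge⁺ (u₁ , w₁ , Pu₁ , Pw₁ , e) (u₂ , w₂ , Pu₂ , Pw₂ , ne) =
    from T-∧ (crossing⁺ Pu₁ Pw₁ (from T-≡ e) , crossing⁺ Pu₂ Pw₂ (from T-not-≡ ne))

  redEdge⁻ : T (redEdge G P ℓ ℓ') → CrossPair G P ℓ ℓ' true × CrossPair G P ℓ ℓ' false
  redEdge⁻ h =
    let h₁ , h₂ = to T-∧ h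
        u₁ , w₁ , Pu₁ , Pw₁ , e  = crossing⁻ h₁
        u₂ , w₂ , Pu₂ , Pw₂ , ne = crossing⁻ h₂
    in (u₁ , w₁ , Pu₁ , Pw₁ , to T-≡ e) , (u₂ , w₂ , Pu₂ , Pw₂ , to T-not-≡ ne)

  redNeighbours⁺ : ℓ ≢ ℓ' → T (redEdge G P ℓ ℓ') → T (redNeighbours G P ℓ ℓ')
  redNeighbours⁺ ℓ≢ℓ' red = from (T-∧ {not ⌊ ℓ ≟ ℓ' ⌋}) (fromWitnessFalse ℓ≢ℓ' , red)

  redNeighbours⁻ : T (redNeighbours G P ℓ ℓ') → ℓ ≢ ℓ' × T (redEdge G P ℓ ℓ')
  redNeighbours⁻ h = Product.map₁ toWitnessFalse (to (T-∧ {not ⌊ ℓ ≟ ℓ' ⌋}) h)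

module _ {n} (G : Graph n) (P : Labelling n) where

  redDeg≤maxRedDeg : ∀ ℓ → redDeg G P ℓ ≤ maxRedDeg G P
  redDeg≤maxRedDeg ℓ = foldr-preservesᵒ (λ a b → [ m≤n⇒m≤n⊔o b , m≤n⇒m≤o⊔n a ]) 0 _
    (inj₂ (Any.map ≤-reflexive (∈-map⁺ (redDeg G P) (∈-allFin ℓ))))

  maxRedDeg≤ : ∀ {c} → (∀ ℓ → redDeg G P ℓ ≤ c) → maxRedDeg G P ≤ c
  maxRedDeg≤ {c} bound = foldr-preservesᵇ {P = _≤ c} ⊔-lub z≤n (All.map⁺ (universal bound (allFin n)))

-- The pair partition and lb₁

minList≤ : ∀ {xs y} → y ∈ xs → minList xs ≤ y
minList≤ {x ∷ xs} {y} y∈x∷xs = foldr-preservesᵒ ⊓≤ x xs (found y∈x∷xs)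
  where
  ⊓≤ : ∀ a b → a ≤ y ⊎ b ≤ y → a ⊓ b ≤ y
  ⊓≤ a b = [ m≤n⇒m⊓o≤n b , m≤n⇒o⊓m≤n a ]
  found : y ∈ x ∷ xs → x ≤ y ⊎ Any (_≤ y) xs
  found (here refl)  = inj₁ ≤-refl
  found (there y∈xs) = inj₂ (Any.map (≤-reflexive ∘ ≡.sym) y∈xs)

module _ {n} (G : Graph n) {x y : Fin n} where

  private
    Q : Labelling n
    Q = pairPartition x y

  lb1≤maxRedDeg : x ≢ y → lb1 G ≤ maxRedDeg G Q
  lb1≤maxRedDeg x≢y =
    minList≤ (∈-concatMap⁺ _ (lose (∈-allFin x) (∈-concatMap⁺ _ (lose (∈-allFin y) pair∈))))
    where
    pair∈ : maxRedDeg G Q ∈ (if ⌊ x ≟ y ⌋ then [] else maxRedDeg G Q ∷ [])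
    pair∈ with x ≟ y
    ... | yes x≡y = contradiction x≡y x≢y
    ... | no  _   = here refl

  pairPartition-fibre : ∀ {w t} → Q w ≡ t → (w ≡ y × t ≡ x) ⊎ (w ≢ y × w ≡ t)
  pairPartition-fibre {w} Qw≡t with w ≟ y
  ... | yes w≡y = inj₁ (w≡y , ≡.sym Qw≡t)
  ... | no  w≢y = inj₂ (w≢y , Qw≡t)

  merged-part : ∀ {w} → Q w ≡ x → w ≡ x ⊎ w ≡ y
  merged-part Qw≡x with pairPartition-fibre Qw≡x
  ... | inj₁ (w≡y , _) = inj₂ w≡y
  ... | inj₂ (_ , w≡x) = inj₁ w≡x

  singleton-part : ∀ {w t} → t ≢ x → Q w ≡ t → w ≡ t × w ≢ y
  singleton-part t≢x Qw≡t with pairPartition-fibre Qw≡t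
  ... | inj₁ (_ , t≡x)   = contradiction t≡x t≢x
  ... | inj₂ (w≢y , w≡t) = w≡t , w≢y

  adj-differs : ∀ {s t z} → s ≡ x ⊎ s ≡ y → t ≡ x ⊎ t ≡ y →
                adj G s z ≡ true → adj G t z ≡ false → T (symDiff G x y z)
  adj-differs (inj₁ refl) (inj₂ refl) e ne rewrite e | ne = tt
  adj-differs (inj₂ refl) (inj₁ refl) e ne rewrite e | ne = tt
  adj-differs (inj₁ refl) (inj₁ refl) e ne = contradiction (trans (≡.sym e) ne) λ ()
  adj-differs (inj₂ refl) (inj₂ refl) e ne = contradiction (trans (≡.sym e) ne) λ ()

  merged-part-red : ∀ {ℓ'} → x ≢ ℓ' → CrossPair G Q x ℓ' true → CrossPair G Q x ℓ' false →
                    T (distinguishers G x y ℓ')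
  merged-part-red x≢ℓ' (s , z₁ , Qs , Qz₁ , e) (t , z₂ , Qt , Qz₂ , ne)
    with singleton-part {z₁} (x≢ℓ' ∘ ≡.sym) Qz₁ | singleton-part {z₂} (x≢ℓ' ∘ ≡.sym) Qz₂
  ... | refl , ℓ'≢y | refl , _ =
    ∖⁺ {p = symDiff G x y ∖ x} ℓ'≢y (∖⁺ {p = symDiff G x y} (x≢ℓ' ∘ ≡.sym)
      (adj-differs (merged-part {s} Qs) (merged-part {t} Qt) e ne))

  singleton-part-red : ∀ {ℓ ℓ'} → ℓ ≢ x → T (redNeighbours G Q ℓ ℓ') →
                       ℓ' ≡ x × T (distinguishers G x y ℓ)
  singleton-part-red {ℓ} {ℓ'} ℓ≢x red with redNeighbours⁻ G Q red
  ... | ℓ≢ℓ' , red' with redEdge⁻ G Q red' | ℓ' ≟ x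
  ... | c , nc | yes refl =
    refl , merged-part-red (ℓ≢x ∘ ≡.sym) (CrossPair-swap G c) (CrossPair-swap G nc)
  ... | (u₁ , w₁ , Qu₁ , Qw₁ , e) , (u₂ , w₂ , Qu₂ , Qw₂ , ne) | no ℓ'≢x
    with singleton-part {u₁} ℓ≢x Qu₁ | singleton-part {u₂} ℓ≢x Qu₂
       | singleton-part {w₁} ℓ'≢x Qw₁ | singleton-part {w₂} ℓ'≢x Qw₂
  ... | refl , _ | refl , _ | refl , _ | refl , _ = contradiction (trans (≡.sym e) ne) λ ()

  redDeg-pairPartition : ∀ ℓ → redDeg G Q ℓ ≤ count (distinguishers G x y)
  redDeg-pairPartition ℓ with ℓ ≟ x
  ... | yes refl = count-mono {p = redNeighbours G Q x} λ ℓ' red →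
    let x≢ℓ' , red' = redNeighbours⁻ G Q red; c , nc = redEdge⁻ G Q red'
    in merged-part-red {ℓ'} x≢ℓ' c nc
  ... | no ℓ≢x = count-injection (λ _ _ → ℓ) (λ ℓ' red → proj₂ (singleton-part-red ℓ≢x red))
    λ ℓ₁ ℓ₂ red₁ red₂ _ →
      trans (proj₁ (singleton-part-red ℓ≢x red₁)) (≡.sym (proj₁ (singleton-part-red ℓ≢x red₂)))

  lb1≤distinguishers : x ≢ y → lb1 G ≤ count (distinguishers G x y)
  lb1≤distinguishers x≢y = ≤-trans (lb1≤maxRedDeg x≢y) (maxRedDeg≤ G Q redDeg-pairPartition)

distinguishers-lower-bound : ∀ {n} (G : Graph n) {d} → (∀ v → degree G v ≡ d) → ∀ {x y} → x ≢ y →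
                             ⌈ lb1 G /2⌉ + ⌈ lb1 G /2⌉ ≤ count (distinguishers G x y)
distinguishers-lower-bound G regular x≢y with distinguishers-even G regular x≢y
... | t , even =
  subst (_ ≤_) (≡.sym even) (⌈/2⌉-double≤ {t = t} (subst (lb1 G ≤_) even (lb1≤distinguishers G x≢y)))

-- Parts meeting a set along a contraction sequence

partsMeeting : ∀ {n} → Labelling n → (Fin n → Bool) → Fin n → Bool
partsMeeting P S ℓ = anyV λ z → S z ∧ inPart P ℓ z

module _ {n} {S : Fin n → Bool} where

  partsMeeting⁺ : ∀ {P : Labelling n} {z} → T (S z) → T (partsMeeting P S (P z))
  partsMeeting⁺ {z = z} Sz = anyV⁺ z (from T-∧ (Sz , fromWitness refl))

  partsMeeting⁻ : ∀ {P : Labelling n} {ℓ} → T (partsMeeting P S ℓ) → ∃ λ z → T (S z) × P z ≡ ℓ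
  partsMeeting⁻ h = let z , h' = anyV⁻ h; Sz , Pz = to T-∧ h' in z , Sz , toWitness Pz

  count≤partsMeeting : ∀ {P : Labelling n} → (∀ u v → P u ≡ P v → u ≡ v) →
                       count S ≤ count (partsMeeting P S)
  count≤partsMeeting {P} P-injective =
    count-injection (λ z _ → P z) (λ z Sz → partsMeeting⁺ Sz) λ u v _ _ → P-injective u v

  partsMeeting-merge : ∀ {P P' : Labelling n} → MergeOf P P' →
                       count (partsMeeting P' S) ≤ suc (count (partsMeeting P S))
  partsMeeting-merge {P} {P'} (x , y , _ , merge) = begin
    count (partsMeeting P' S)
      ≡⟨ count-remove (partsMeeting P' S) (P' y) ⟩
    𝟙 (partsMeeting P' S (P' y)) + count (partsMeeting P' S ∖ P' y)
      ≤⟨ +-mono-≤ (𝟙≤1 _) (count-injection (λ _ h → P (proj₁ (rep h)))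
                                           (λ _ h → partsMeeting⁺ (proj₁ (proj₂ (rep h))))
                                           rep-injective) ⟩
    suc (count (partsMeeting P S))
      ∎
    where
    open ℕ.≤-Reasoning
    rep : ∀ {ℓ} → T ((partsMeeting P' S ∖ P' y) ℓ) → ∃ λ z → T (S z) × P' z ≡ ℓ
    rep h = partsMeeting⁻ (proj₂ (∖⁻ {p = partsMeeting P' S} h))
    rep-injective : ∀ ℓ₁ ℓ₂ h₁ h₂ → P (proj₁ (rep {ℓ₁} h₁)) ≡ P (proj₁ (rep {ℓ₂} h₂)) → ℓ₁ ≡ ℓ₂
    label : ∀ {ℓ} (h : T ((partsMeeting P' S ∖ P' y) ℓ)) → P' (proj₁ (rep h)) ≡ ℓ
    label h = proj₂ (proj₂ (rep h))
    outside-y : ∀ {ℓ} → T ((partsMeeting P' S ∖ P' y) ℓ) → ℓ ≢ P' y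
    outside-y h = proj₁ (∖⁻ {p = partsMeeting P' S} h)
    rep-injective ℓ₁ ℓ₂ h₁ h₂ eq with proj₁ (merge (proj₁ (rep h₁)) (proj₁ (rep h₂))) eq
    ... | inj₁ same              = trans (≡.sym (label h₁)) (trans same (label h₂))
    ... | inj₂ (inj₁ (_ , z₂∈y)) = contradiction (trans (≡.sym (label h₂)) z₂∈y) (outside-y h₂)
    ... | inj₂ (inj₂ (z₁∈y , _)) = contradiction (trans (≡.sym (label h₁)) z₁∈y) (outside-y h₁)

module _ {n k} {P : ℕ → Labelling n} (pcs : PartialContractionSequence n k P) (S : Fin n → Bool) where
  open PartialContractionSequence pcs

  count≤partsMeeting+steps : ∀ m i → i + m ≡ n → k ≤ i → count S ≤ count (partsMeeting (P i) S) + m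
  count≤partsMeeting+steps zero i i+0≡n _ with trans (≡.sym (+-identityʳ i)) i+0≡n
  ... | refl = subst (count S ≤_) (≡.sym (+-identityʳ _)) (count≤partsMeeting discrete)
  count≤partsMeeting+steps (suc m) i i+1+m≡n k≤i = begin
    count S
      ≤⟨ count≤partsMeeting+steps m (suc i) (trans (≡.sym (+-suc i m)) i+1+m≡n) (m≤n⇒m≤1+n k≤i) ⟩
    count (partsMeeting (P (suc i)) S) + m
      ≤⟨ +-monoˡ-≤ m (partsMeeting-merge (merges i k≤i i<n)) ⟩
    suc (count (partsMeeting (P i) S)) + m
      ≡⟨ +-suc _ m ⟨
    count (partsMeeting (P i) S) + suc m
      ∎
    where
    open ℕ.≤-Reasoning
    i<n : i < n
    i<n = subst (i <_) i+1+m≡n (m<m+n i (s≤s z≤n))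

-- Three vertices in one part

splits : ∀ {n} → Graph n → Fin n → Fin n → Fin n → Fin n → Bool
splits G u v w z = symDiff G u v z ∨ symDiff G u w z

outerSplitters : ∀ {n} → Graph n → Fin n → Fin n → Fin n → Fin n → Bool
outerSplitters G u v w = splits G u v w ∖ u ∖ v ∖ w

𝟙-xor-triangle : ∀ a b c → 𝟙 (a xor b) + 𝟙 (a xor c) + 𝟙 (b xor c)
                         ≡ 𝟙 ((a xor b) ∨ (a xor c)) + 𝟙 ((a xor b) ∨ (a xor c))
𝟙-xor-triangle false false false = refl
𝟙-xor-triangle false false true  = refl
𝟙-xor-triangle false true  false = refl
𝟙-xor-triangle false true  true  = refl
𝟙-xor-triangle true  false false = refl
𝟙-xor-triangle true  false true  = refl
𝟙-xor-triangle true  true  false = refl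
𝟙-xor-triangle true  true  true  = refl

module _ {n} (G : Graph n) (Q : Labelling n) {ℓ : Fin n} where

  symDiff-red : ∀ {s t z} → Q s ≡ ℓ → Q t ≡ ℓ → T (symDiff G s t z) → T (redEdge G Q ℓ (Q z))
  symDiff-red {s} {t} {z} Qs Qt h with adj G s z in e₁ | adj G t z in e₂
  ... | true  | false = redEdge⁺ G Q (s , z , Qs , refl , e₁) (t , z , Qt , refl , e₂)
  ... | false | true  = redEdge⁺ G Q (t , z , Qt , refl , e₂) (s , z , Qs , refl , e₁)

  splits-red : ∀ {u v w z} → Q u ≡ ℓ → Q v ≡ ℓ → Q w ≡ ℓ → T (splits G u v w z) →
               T (redEdge G Q ℓ (Q z))
  splits-red Qu Qv Qw h = [ symDiff-red Qu Qv , symDiff-red Qu Qw ] (to T-∨ h)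

  partsMeeting-splits : ∀ {u v w} → Q u ≡ ℓ → Q v ≡ ℓ → Q w ≡ ℓ →
    count (partsMeeting Q λ z → splits G u v w z ∨ inPart Q ℓ z) ≤ suc (redDeg G Q ℓ)
  partsMeeting-splits {u} {v} {w} Qu Qv Qw = count-≤-suc {q = redNeighbours G Q ℓ} red-unless-ℓ
    where
    red-unless-ℓ : ∀ ℓ' → ℓ' ≢ ℓ → T (partsMeeting Q (λ z → splits G u v w z ∨ inPart Q ℓ z) ℓ') →
                   T (redNeighbours G Q ℓ ℓ')
    red-unless-ℓ ℓ' ℓ'≢ℓ h with partsMeeting⁻ {S = λ z → splits G u v w z ∨ inPart Q ℓ z} h
    ... | z , h' , refl = redNeighbours⁺ G Q (ℓ'≢ℓ ∘ ≡.sym)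
      ([ splits-red Qu Qv Qw , (λ z∈ℓ → contradiction (toWitness z∈ℓ) ℓ'≢ℓ) ]
         (to (T-∨ {splits G u v w z}) h'))

module _ {n} (G : Graph n) {u v w : Fin n} (u≢v : u ≢ v) (u≢w : u ≢ w) (v≢w : v ≢ w) where

  private
    M : Fin n → Bool
    M = outerSplitters G u v w

  distinguishers-pointwise : ∀ z →
      𝟙 (distinguishers G u v z) + 𝟙 (distinguishers G u w z) + 𝟙 (distinguishers G v w z)
    ≤ 𝟙 ⌊ z ≟ u ⌋ + 𝟙 ⌊ z ≟ v ⌋ + 𝟙 ⌊ z ≟ w ⌋ + (𝟙 (M z) + 𝟙 (M z))
  distinguishers-pointwise z with z ≟ u | z ≟ v | z ≟ w
  ... | no _    | no _    | no _    = ≤-reflexive (𝟙-xor-triangle (adj G u z) (adj G v z) (adj G w z))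
  ... | yes _   | no _    | no _    = 𝟙≤1 (symDiff G v w z)
  ... | no _    | yes _   | no _    = ≤-trans (≤-reflexive (+-identityʳ _)) (𝟙≤1 (symDiff G u w z))
  ... | no _    | no _    | yes _   =
    ≤-trans (≤-reflexive (trans (+-identityʳ _) (+-identityʳ _))) (𝟙≤1 (symDiff G u v z))
  ... | yes z≡u | yes z≡v | _       = contradiction (trans (≡.sym z≡u) z≡v) u≢v
  ... | yes z≡u | no _    | yes z≡w = contradiction (trans (≡.sym z≡u) z≡w) u≢w
  ... | no _    | yes z≡v | yes z≡w = contradiction (trans (≡.sym z≡v) z≡w) v≢w

  distinguishers-triangle : count (distinguishers G u v) + count (distinguishers G u w)
                            + count (distinguishers G v w) ≤ 3 + (count M + count M)
  distinguishers-triangle = begin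
    count (distinguishers G u v) + count (distinguishers G u w) + count (distinguishers G v w)
      ≡⟨ count-+₃ (distinguishers G u v) (distinguishers G u w) (distinguishers G v w) ⟨
    ∑[ z < n ] (𝟙 (distinguishers G u v z) + 𝟙 (distinguishers G u w z) + 𝟙 (distinguishers G v w z))
      ≤⟨ ∑-mono distinguishers-pointwise ⟩
    ∑[ z < n ] (𝟙 (at u z) + 𝟙 (at v z) + 𝟙 (at w z) + (𝟙 (M z) + 𝟙 (M z)))
      ≡⟨ ∑-distrib-+ (λ z → 𝟙 (at u z) + 𝟙 (at v z) + 𝟙 (at w z)) (λ z → 𝟙 (M z) + 𝟙 (M z)) ⟩
    ∑[ z < n ] (𝟙 (at u z) + 𝟙 (at v z) + 𝟙 (at w z)) + ∑[ z < n ] (𝟙 (M z) + 𝟙 (M z))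
      ≡⟨ cong₂ _+_ (count-+₃ (at u) (at v) (at w)) (count-+ M M) ⟩
    count (at u) + count (at v) + count (at w) + (count M + count M)
      ≤⟨ +-monoˡ-≤ _ (+-mono-≤ (+-mono-≤ (count-singleton u) (count-singleton v)) (count-singleton w)) ⟩
    3 + (count M + count M)
      ∎
    where
    open ℕ.≤-Reasoning
    at : Fin n → Fin n → Bool
    at x z = ⌊ z ≟ x ⌋

  3+outerSplitters≤ : ∀ {S : Fin n → Bool} → T (S u) → T (S v) → T (S w) →
                      (∀ z → T (splits G u v w z) → T (S z)) → 3 + count M ≤ count S
  3+outerSplitters≤ {S} Su Sv Sw splits⊆S = begin
    3 + count M                ≤⟨ +-monoʳ-≤ 3 (count-mono (∖-mono (∖-mono (∖-mono splits⊆S)))) ⟩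
    3 + count (S ∖ u ∖ v ∖ w)  ≡⟨ cong (2 +_) (count-remove-∈ (S ∖ u ∖ v) w∈) ⟨
    2 + count (S ∖ u ∖ v)      ≡⟨ cong suc (count-remove-∈ (S ∖ u) v∈) ⟨
    suc (count (S ∖ u))        ≡⟨ count-remove-∈ S Su ⟨
    count S                    ∎
    where
    open ℕ.≤-Reasoning
    v∈ : T ((S ∖ u) v)
    v∈ = ∖⁺ {p = S} (u≢v ∘ ≡.sym) Sv
    w∈ : T ((S ∖ u ∖ v) w)
    w∈ = ∖⁺ {p = S ∖ u} (v≢w ∘ ≡.sym) (∖⁺ {p = S} (u≢w ∘ ≡.sym) Sw)

  three-in-a-part-impossible :
    ∀ {d} → (∀ v → degree G v ≡ d) → ∀ {Q : Labelling n} → Q v ≡ Q u → Q w ≡ Q u →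
    redDeg G Q (Q u) ≤ lb1 G →
    ∀ {m} → (∀ S → count S ≤ count (partsMeeting Q S) + m) → m ≤ ⌈ lb1 G /2⌉ → ⊥
  three-in-a-part-impossible regular {Q} Qv Qw redDeg≤lb1 {m} few-merges m≤a =
    incompatible-bounds (count M) a upper lower
    where
    a : ℕ
    a = ⌈ lb1 G /2⌉
    S : Fin n → Bool
    S z = splits G u v w z ∨ inPart Q (Q u) z
    part : ∀ {z} → Q z ≡ Q u → T (S z)
    part {z} Qz = from (T-∨ {splits G u v w z}) (inj₂ (fromWitness Qz))
    upper : 3 + count M ≤ suc (a + a) + a
    upper = begin
      3 + count M                   ≤⟨ 3+outerSplitters≤ (part refl) (part Qv) (part Qw)
                                          (λ z → from (T-∨ {splits G u v w z}) ∘ inj₁) ⟩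
      count S                       ≤⟨ few-merges S ⟩
      count (partsMeeting Q S) + m  ≤⟨ +-mono-≤ (partsMeeting-splits G Q refl Qv Qw) m≤a ⟩
      suc (redDeg G Q (Q u)) + a    ≤⟨ +-monoˡ-≤ a (s≤s (≤-trans redDeg≤lb1 (≤⌈/2⌉-double (lb1 G)))) ⟩
      suc (a + a) + a               ∎
      where open ℕ.≤-Reasoning
    lower : (a + a) + (a + a) + (a + a) ≤ 3 + (count M + count M)
    lower = ≤-trans (+-mono-≤ (+-mono-≤ (Δ≥ u≢v) (Δ≥ u≢w)) (Δ≥ v≢w)) distinguishers-triangle
      where Δ≥ = distinguishers-lower-bound G regular

lemma4p2 : {n : ℕ} (G : Graph n) (d lam mu : ℕ) → StronglyRegular G d lam mu →
    (k : ℕ) (P : ℕ → Labelling n) → PartialContractionSequence n k P →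
    WidthAtMost G k P (lb1 G) →
    ∀ i → k ≤ i → i ≤ n → n ∸ ⌈ lb1 G /2⌉ ≤ i →
    ∀ (u : Fin n) → partSize (P i) u ≤ 2
lemma4p2 {n} G d lam mu srg k P pcs width i k≤i i≤n late u with partSize (P i) u ≤? 2
... | yes small = small
... | no  large =
  let v , w , u≢v , u≢w , v≢w , v∈ , w∈ = three-elements (≰⇒> large) (fromWitness refl)
  in ⊥-elim $ three-in-a-part-impossible G u≢v u≢w v≢w (StronglyRegular.regular srg)
       (toWitness v∈) (toWitness w∈)
       (≤-trans (redDeg≤maxRedDeg G (P i) (P i u)) (width i k≤i i≤n))
       (λ S → count≤partsMeeting+steps pcs S (n ∸ i) i (m+[n∸m]≡n i≤n) k≤i)
       (m∸n≤o⇒m∸o≤n n ⌈ lb1 G /2⌉ i late)
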